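{- Let $k\ge 3$ and let $\sigma$ be a pattern of length $k$ whose underlying permutation is $k(k-1)\cdots 1$ (with an arbitrary choice of underlined blocks of consecutive entries). Then for every $n\ge1$, $\mathrm{Sort}_n(\mathfrak{s}_\sigma)=\mathrm{Av}_n(\mathrm{rev}(\sigma),132)$.
   Context: A pattern is a permutation $\sigma\in\mathfrak S_k$ in which some blocks of consecutive entries may be underlined. A sequence $w$ of distinct numbers contains $\sigma$ if it has a subsequence order-isomorphic to $\sigma$ such that entries corresponding to entries of $\sigma$ in a common underlined block occupy adjacent positions of $w$. $\mathrm{Av}_n(\dots)$ is the set of $\tau\in\mathfrak S_n$ avoiding all listed patterns. $\mathrm{rev}(\sigma)$ is the reverse of $\sigma$, with the underlining reversed along with the entries (so $\mathrm{rev}(\sigma)$ has underlying permutation $12\cdots k$). Pattern-avoiding stack map $\mathfrak{s}_\sigma$: process the input $\tau_1,\dots,\tau_n$ in order; when $\tau_i$ is next, while the stack is nonempty and the sequence formed by placing $\tau_i$ on top of the stack, read top to bottom, contains $\sigma$ (underlined entries adjacent in the stack), pop the top entry to the output; then push $\tau_i$. At the end pop all remaining entries top to bottom to the output; the output is $\mathfrak{s}_\sigma(\tau)$. West's stack-sorting map $s$ pushes each input entry after first popping all smaller stack entries to the output, and empties the stack at the end. $\mathrm{Sort}_n(\mathfrak{s}_\sigma)=\{\tau\in\mathfrak S_n: s(\mathfrak{s}_\sigma(\tau))=12\cdots n\}$ (equivalently, $\mathfrak{s}_\sigma(\tau)$ avoids $231$). -}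

module Defs where

open import Data.Nat using (ℕ; zero; suc; _<ᵇ_; _≡ᵇ_)
open import Data.Bool using (Bool; true; false; _∧_; _∨_; not; if_then_else_)
open import Data.List using (List; []; _∷_; _++_; [_]; map; zip; upTo; downFrom; reverse; length)
open import Data.Bool.ListAction using (any; all)
open import Data.Product using (_×_; _,_; proj₁; proj₂)

_==_ : Bool → Bool → Bool
true  == b = b
false == b = not b

-- A pattern: underlying permutation (one-line notation, as a list of
-- the values 1..k) together with underlining data.  The underlining is
-- encoded by a list of k-1 booleans: the j-th boolean (0-based) is true
-- iff entries j and j+1 of the pattern lie in a common underlined block.
-- (Any family of disjoint blocks of consecutive entries is encoded this way.)
Pattern : Set
Pattern = List ℕ × List Bool

choose : {A : Set} → ℕ → List A → List (List A)
choose zero    _        = [ [] ]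
choose (suc k) []       = []
choose (suc k) (x ∷ xs) = map (x ∷_) (choose k xs) ++ choose (suc k) xs

-- Order-isomorphism of two sequences (for sequences of distinct numbers):
-- same length, and for every pair of positions a < b the relative order agrees.
orderIso : List ℕ → List ℕ → Bool
orderIso []       []       = true
orderIso (s ∷ ss) (v ∷ vs) =
  all (λ q → (s <ᵇ proj₁ q) == (v <ᵇ proj₂ q)) (zip ss vs) ∧ orderIso ss vs
orderIso _        _        = false

-- Adjacency constraint: if the j-th underlining bit is true, the positions
-- (in w) of the j-th and (j+1)-st chosen entries are consecutive.
adjOK : List Bool → List ℕ → Bool
adjOK (b ∷ bs) (p ∷ q ∷ ps) = (not b ∨ (q ≡ᵇ suc p)) ∧ adjOK bs (q ∷ ps)
adjOK _        _            = true

contains : List ℕ → Pattern → Bool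
contains w (σ , u) =
  any (λ c → orderIso σ (map proj₂ c) ∧ adjOK u (map proj₁ c))
      (choose (length σ) (zip (upTo (length w)) w))

Avoids : List ℕ → Pattern → Set
Avoids w p = contains w p ≡ false
  where open import Relation.Binary.PropositionalEquality using (_≡_)

revPat : Pattern → Pattern
revPat (σ , u) = reverse σ , reverse u

p132 : Pattern
p132 = (1 ∷ 3 ∷ 2 ∷ []) , (false ∷ false ∷ [])

decr : ℕ → List ℕ
decr k = map suc (downFrom k)

idPerm : ℕ → List ℕ
idPerm n = map suc (upTo n)

-- The stack is a list with its head as the top.
-- `pop? x st` decides whether, with x next in the input and stack st
-- (nonempty), the top of the stack must be popped.
-- popWhile pops while the stack is nonempty and pop? holds, appending
-- popped entries to the output.
popWhile : (ℕ → List ℕ → Bool) → ℕ → List ℕ → List ℕ → List ℕ × List ℕ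
popWhile pop? x []       out = [] , out
popWhile pop? x (y ∷ st) out =
  if pop? x (y ∷ st) then popWhile pop? x st (out ++ [ y ]) else ((y ∷ st) , out)

runStack : (ℕ → List ℕ → Bool) → List ℕ → List ℕ → List ℕ → List ℕ
runStack pop? []       st out = out ++ st
runStack pop? (x ∷ xs) st out with popWhile pop? x st out
... | st' , out' = runStack pop? xs (x ∷ st') out'

-- Pattern-avoiding stack map s_σ: pop while (x placed on top of the stack,
-- read top to bottom) contains σ.
sPat : Pattern → List ℕ → List ℕ
sPat σ τ = runStack (λ x st → contains (x ∷ st) σ) τ [] []

west : List ℕ → List ℕ
west τ = runStack popSmall τ [] []
  where
  popSmall : ℕ → List ℕ → Bool
  popSmall x []      = false
  popSmall x (y ∷ _) = y <ᵇ x

module Submission where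

-- While 𝔰_σ has popped nothing, its stack read top to bottom is the reversed prefix of τ
-- read so far.  So if reverse τ avoids σ, i.e. τ avoids rev(σ), nothing is popped before the
-- end and 𝔰_σ(τ) = reverse τ.  West's map sorts a permutation iff it avoids 231, and reverse τ
-- avoids 231 iff τ avoids 132.
-- If instead reverse τ contains σ, let x be the first entry whose arrival causes pops, and z
-- the last entry those pops remove, with rest below z.  Then x z rest contains σ while neither
-- z rest nor x rest does, so an occurrence of σ starts with x, z and continues with some c in
-- rest; as σ is decreasing, c < z < x.  Now z is output before x, and x lies above c in the
-- stack, so the output contains the 231-pattern z x c and is not West-sortable.

open import Defs
open import Data.Nat using (ℕ; zero; suc; _+_; _∸_; _≤_; _<_; _≥_; _>_; _<ᵇ_; _≡ᵇ_; z≤n; s≤s; s<s)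
open import Data.Nat.Properties
  using ( ≤-trans; <-trans; ≤-<-trans; <⇒≤; <⇒≢; <⇒≱; ≮⇒≥; ≤∧≢⇒<; <-asym; ≤-totalOrder
        ; <ᵇ⇒<; <⇒<ᵇ; ≡ᵇ⇒≡; ≡⇒≡ᵇ; +-suc; +-identityʳ; +-cancelˡ-≡; suc-injective)
open import Data.Bool using (Bool; true; false; T; not; _∧_; _∨_)
open import Data.Bool.Properties using (T-∧; T-≡)
open import Data.Bool.ListAction using (all)
open import Data.List
  using (List; []; _∷_; _++_; [_]; map; zip; applyUpTo; upTo; downFrom; reverse; length; _ʳ++_)
open import Data.List.Properties
  using ( ∷-injectiveʳ; ++-assoc; ++-identityʳ; unfold-reverse; reverse-++; reverse-involutive
        ; length-reverse; length-map; length-downFrom)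
open import Data.List.Relation.Unary.All as All using (All; []; _∷_)
open import Data.List.Relation.Unary.Any using (here; there)
open import Data.List.Relation.Unary.Any.Properties using (any⁺; any⁻)
open import Data.List.Relation.Unary.AllPairs as AllPairs using (AllPairs; []; _∷_)
import Data.List.Relation.Unary.AllPairs.Properties as AllPairsₚ
open import Data.List.Relation.Unary.Unique.Propositional using (Unique)
import Data.List.Relation.Unary.Sorted.TotalOrder.Properties as Sortedₚ
open import Data.List.Relation.Binary.Pointwise using (Pointwise-≡⇒≡)
open import Data.List.Membership.Propositional using (_∈_; find; lose)
open import Data.List.Membership.Propositional.Properties
  using (∈-++⁻; ∈-++⁺ˡ; ∈-++⁺ʳ; ∈-map⁺; ∈-map⁻)
open import Data.List.Relation.Binary.Sublist.Propositional
  using (_⊆_; []; _∷_; _∷ʳ_; ⊆-refl; ⊆-trans; from∈; to∈)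
import Data.List.Relation.Binary.Sublist.Propositional.Properties as Sublistₚ
open import Data.List.Relation.Binary.Permutation.Propositional
  using (_↭_; ↭-sym; ↭-trans; ↭-reflexive; ↭⇒↭ₛ; ↭⇒↭ₛ′)
open import Data.List.Relation.Binary.Permutation.Propositional.Properties
  using (All-resp-↭; ∈-resp-↭; shift; ++⁺ˡ; ↭-reverse)
import Data.List.Relation.Binary.Permutation.Setoid.Properties as PermutationSetoidₚ
open import Data.Product using (_×_; _,_; proj₁; proj₂; ∃-syntax; Σ-syntax)
open import Data.Sum using (_⊎_; inj₁; inj₂)
open import Function.Base using (_∘_)
open import Function.Bundles using (_⇔_; mk⇔; Equivalence)
import Function.Properties.Equivalence as ⇔
open import Relation.Nullary using (¬_; contradiction)
open import Relation.Binary.PropositionalEquality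
  using (_≡_; refl; sym; trans; cong; cong₂; subst; subst₂; setoid; isEquivalence; module ≡-Reasoning)

AllPairs-resp-⊆ : ∀ {R : ℕ → ℕ → Set} {xs ys} → xs ⊆ ys → AllPairs R ys → AllPairs R xs
AllPairs-resp-⊆ []             []         = []
AllPairs-resp-⊆ (_ ∷ʳ xs⊆ys)   (_ ∷ pys)  = AllPairs-resp-⊆ xs⊆ys pys
AllPairs-resp-⊆ (refl ∷ xs⊆ys) (py ∷ pys) = Sublistₚ.All-resp-⊆ xs⊆ys py ∷ AllPairs-resp-⊆ xs⊆ys pys

AllPairs-reverse : ∀ {R : ℕ → ℕ → Set} {xs} → AllPairs R xs → AllPairs (λ a b → R b a) (reverse xs)
AllPairs-reverse {xs = []}     []         = []
AllPairs-reverse {xs = x ∷ xs} (px ∷ pxs) rewrite unfold-reverse x xs =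
  AllPairsₚ.++⁺ (AllPairs-reverse pxs) ([] ∷ [])
    (All.map (_∷ []) (All-resp-↭ (↭-sym (↭-reverse xs)) px))

⊆-ʳ++ : ∀ (xs : List ℕ) {ys} → ys ⊆ xs ʳ++ ys
⊆-ʳ++ xs = Sublistₚ.ʳ++⁺ (Sublistₚ.[]⊆-universal xs) ⊆-refl

ascending-↭⇒≡ : ∀ {xs ys} → AllPairs _≤_ xs → AllPairs _≤_ ys → xs ↭ ys → xs ≡ ys
ascending-↭⇒≡ xs↗ ys↗ xs↭ys = Pointwise-≡⇒≡ (Sortedₚ.↗↭↗⇒≋ ≤-totalOrder
  (Sortedₚ.AllPairs⇒Sorted ≤-totalOrder xs↗) (Sortedₚ.AllPairs⇒Sorted ≤-totalOrder ys↗)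
  (↭⇒↭ₛ′ isEquivalence xs↭ys))

idPerm-increasing : ∀ n → AllPairs _<_ (idPerm n)
idPerm-increasing n = AllPairsₚ.map⁺ (AllPairsₚ.applyUpTo⁺₁ (λ i → i) n (λ i<j _ → s<s i<j))

↭-idPerm⇒unique : ∀ {n w} → w ↭ idPerm n → Unique w
↭-idPerm⇒unique {n} w↭id =
  PermutationSetoidₚ.Unique-resp-↭ (setoid ℕ) (↭⇒↭ₛ (↭-sym w↭id))
    (AllPairs.map <⇒≢ (idPerm-increasing n))

≡false⇔¬T : ∀ {b} → b ≡ false ⇔ (¬ T b)
≡false⇔¬T {false} = mk⇔ (λ _ ()) (λ _ → refl)
≡false⇔¬T {true}  = mk⇔ (λ ()) (λ ¬t → contradiction _ ¬t)

<ᵇ≡true⇔< : ∀ {m n} → (m <ᵇ n) ≡ true ⇔ m < n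
<ᵇ≡true⇔< {m} {n} = mk⇔ (<ᵇ⇒< m n ∘ Equivalence.from T-≡) (Equivalence.to T-≡ ∘ <⇒<ᵇ)

<ᵇ≡false⇔≥ : ∀ {m n} → (m <ᵇ n) ≡ false ⇔ m ≥ n
<ᵇ≡false⇔≥ {m} {n} = mk⇔
  (λ m<ᵇn≡false → ≮⇒≥ (Equivalence.to ≡false⇔¬T m<ᵇn≡false ∘ <⇒<ᵇ))
  (λ m≥n → Equivalence.from ≡false⇔¬T (λ m<ᵇn → <⇒≱ (<ᵇ⇒< m n m<ᵇn) m≥n))

-- The comparison is a parameter because the stack argument only yields non-strict inequalities,
-- which distinct entries make strict.
Has231 : (ℕ → ℕ → Set) → List ℕ → Set
Has231 _≺_ w = ∃[ b ] ∃[ c ] ∃[ a ] (b ∷ c ∷ a ∷ []) ⊆ w × a ≺ b × b ≺ c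

unique⇒strict231 : ∀ {w} → Unique w → Has231 _≤_ w → Has231 _<_ w
unique⇒strict231 w! (b , c , a , bca⊆w , a≤b , b≤c) with AllPairs-resp-⊆ bca⊆w w!
... | (b≢c ∷ b≢a ∷ []) ∷ _ = b , c , a , bca⊆w , ≤∧≢⇒< a≤b (b≢a ∘ sym) , ≤∧≢⇒< b≤c b≢c

-- Stack machines

module _ (pop? : ℕ → List ℕ → Bool) where

  popWhile-shape : ∀ x st out → ∃[ P ] st ≡ P ++ proj₁ (popWhile pop? x st out)
                                     × proj₂ (popWhile pop? x st out) ≡ out ++ P
  popWhile-shape x []       out = [] , refl , sym (++-identityʳ out)
  popWhile-shape x (y ∷ st) out with pop? x (y ∷ st)
  ... | false = [] , refl , sym (++-identityʳ out)
  ... | true with popWhile-shape x st (out ++ [ y ])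
  ...   | P , st≡ , out≡ = y ∷ P , cong (y ∷_) st≡ , trans out≡ (++-assoc out [ y ] P)

  popWhile-keeps-out : ∀ {b} x st out → b ∈ out → b ∈ proj₂ (popWhile pop? x st out)
  popWhile-keeps-out x st out b∈out with popWhile-shape x st out
  ... | P , _ , out≡ = subst (_ ∈_) (sym out≡) (∈-++⁺ˡ b∈out)

  popWhile-stack⊎out : ∀ {b} x st out → b ∈ st →
    b ∈ proj₁ (popWhile pop? x st out) ⊎ b ∈ proj₂ (popWhile pop? x st out)
  popWhile-stack⊎out x st out b∈st with popWhile-shape x st out
  ... | P , st≡ , out≡ with ∈-++⁻ P (subst (_ ∈_) st≡ b∈st)
  ...   | inj₁ b∈P   = inj₂ (subst (_ ∈_) (sym out≡) (∈-++⁺ʳ out b∈P))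
  ...   | inj₂ b∈st′ = inj₁ b∈st′

  runStack-shape : ∀ xs st out → ∃[ R ] runStack pop? xs st out ≡ out ++ R × st ⊆ R × R ↭ st ++ xs
  runStack-shape []       st out = st , refl , ⊆-refl , ↭-reflexive (sym (++-identityʳ st))
  runStack-shape (x ∷ xs) st out with popWhile-shape x st out
  ... | P , st≡ , out≡
    with runStack-shape xs (x ∷ proj₁ (popWhile pop? x st out)) (proj₂ (popWhile pop? x st out))
  ...   | R , run≡ , x∷st′⊆R , R↭ =
    P ++ R ,
    trans run≡ (trans (cong (_++ R) out≡) (++-assoc out P R)) ,
    subst (_⊆ P ++ R) (sym st≡) (Sublistₚ.++⁺ ⊆-refl (Sublistₚ.∷ˡ⁻ x∷st′⊆R)) ,
    subst (λ s → P ++ R ↭ s ++ x ∷ xs) (sym st≡)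
      (↭-trans (++⁺ˡ P (↭-trans R↭ (↭-sym (shift x _ xs))))
               (↭-reflexive (sym (++-assoc P _ (x ∷ xs)))))

  runStack-↭ : ∀ xs → runStack pop? xs [] [] ↭ xs
  runStack-↭ xs with runStack-shape xs [] []
  ... | R , run≡ , _ , R↭ = subst (_↭ xs) (sym run≡) R↭

  runStack-⊇ : ∀ {O S} xs st out → O ⊆ out → S ⊆ st → O ++ S ⊆ runStack pop? xs st out
  runStack-⊇ xs st out O⊆out S⊆st with runStack-shape xs st out
  ... | R , run≡ , st⊆R , _ = subst (_ ⊆_) (sym run≡) (Sublistₚ.++⁺ O⊆out (⊆-trans S⊆st st⊆R))

  runStack-precedes : ∀ {a b} xs st out → b ∈ out → a ∈ st ++ xs →
    (b ∷ a ∷ []) ⊆ runStack pop? xs st out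
  runStack-precedes xs st out b∈out a∈ with runStack-shape xs st out
  ... | R , run≡ , _ , R↭ =
    subst (_ ⊆_) (sym run≡) (Sublistₚ.++⁺ (from∈ b∈out) (from∈ (∈-resp-↭ (↭-sym R↭) a∈)))

-- West's stack-sorting map

-- The pop test of `west` is local to its definition, so it enters through its defining equation.
module WestStack (pop? : ℕ → List ℕ → Bool) (pop?-spec : ∀ x y st → pop? x (y ∷ st) ≡ (y <ᵇ x)) where

  -- st ʳ++ xs (the stack bottom to top, then the unread input) is a subsequence of the input.
  record Sortable (xs st out : List ℕ) : Set where
    field
      out-ascending   : AllPairs _≤_ out
      out-below       : ∀ {o r} → o ∈ out → r ∈ st ++ xs → o ≤ r
      stack-ascending : AllPairs _≤_ st
      no-231          : ¬ Has231 _<_ (st ʳ++ xs)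

  pop-sortable : ∀ {x xs y st out} → y < x →
    Sortable (x ∷ xs) (y ∷ st) out → Sortable (x ∷ xs) st (out ++ [ y ])
  pop-sortable {x} {xs} {y} {st} {out} y<x s = record
    { out-ascending   = AllPairsₚ.++⁺ out-ascending ([] ∷ [])
                          (All.tabulate (λ o∈ → out-below o∈ (here refl) ∷ []))
    ; out-below       = below
    ; stack-ascending = AllPairs.tail stack-ascending
    ; no-231          = λ (b , c , a , bca⊆ , a<b , b<c) → no-231 (b , c , a , ⊆-trans bca⊆ drop-y , a<b , b<c)
    }
    where
    open Sortable s
    drop-y : st ʳ++ x ∷ xs ⊆ st ʳ++ y ∷ x ∷ xs
    drop-y = Sublistₚ.ʳ++⁺ (⊆-refl {x = st}) (y ∷ʳ ⊆-refl)
    y-below : ∀ {r} → r ∈ st ++ x ∷ xs → y ≤ r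
    y-below r∈ with ∈-++⁻ st r∈
    ... | inj₁ r∈st         = All.lookup (AllPairs.head stack-ascending) r∈st
    ... | inj₂ (here refl)  = <⇒≤ y<x
    ... | inj₂ (there r∈xs) = ≮⇒≥ λ r<y →
      no-231 (y , x , _ , ⊆-trans (refl ∷ refl ∷ from∈ r∈xs) (⊆-ʳ++ st) , r<y , y<x)
    below : ∀ {o r} → o ∈ out ++ [ y ] → r ∈ st ++ x ∷ xs → o ≤ r
    below o∈ r∈ with ∈-++⁻ out o∈
    ... | inj₁ o∈out       = out-below o∈out (there r∈)
    ... | inj₂ (here refl) = y-below r∈

  push-sortable : ∀ {x xs st out} → All (x ≤_) st → Sortable (x ∷ xs) st out → Sortable xs (x ∷ st) out
  push-sortable {x} {xs} {st} x≤st s = record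
    { out-ascending   = out-ascending
    ; out-below       = λ o∈ r∈ → out-below o∈ (∈-resp-↭ (↭-sym (shift x st xs)) r∈)
    ; stack-ascending = x≤st ∷ stack-ascending
    ; no-231          = no-231
    }
    where open Sortable s

  popWhile-sortable : ∀ {x xs} st out → Sortable (x ∷ xs) st out →
    Sortable xs (x ∷ proj₁ (popWhile pop? x st out)) (proj₂ (popWhile pop? x st out))
  popWhile-sortable         []       out s = push-sortable [] s
  popWhile-sortable {x} (y ∷ st) out s rewrite pop?-spec x y st with y <ᵇ x in y<ᵇx
  ... | true  = popWhile-sortable st (out ++ [ y ]) (pop-sortable (Equivalence.to <ᵇ≡true⇔< y<ᵇx) s)
  ... | false = push-sortable (x≤y ∷ All.map (≤-trans x≤y) (AllPairs.head (Sortable.stack-ascending s))) s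
    where
    x≤y : x ≤ y
    x≤y = Equivalence.to <ᵇ≡false⇔≥ y<ᵇx

  runStack-ascending : ∀ xs st out → Sortable xs st out → AllPairs _≤_ (runStack pop? xs st out)
  runStack-ascending []       st out s = AllPairsₚ.++⁺ out-ascending stack-ascending
    (All.tabulate λ o∈ → All.tabulate λ r∈ → out-below o∈ (∈-++⁺ˡ r∈))
    where open Sortable s
  runStack-ascending (x ∷ xs) st out s = runStack-ascending xs _ _ (popWhile-sortable st out s)

  avoids231⇒ascending : ∀ {w} → ¬ Has231 _<_ w → AllPairs _≤_ (runStack pop? w [] [])
  avoids231⇒ascending {w} no231 = runStack-ascending w [] [] record
    { out-ascending = [] ; out-below = λ () ; stack-ascending = [] ; no-231 = no231 }

  popWhile-ascending : ∀ {x} st out → AllPairs _≤_ st → AllPairs _≤_ (x ∷ proj₁ (popWhile pop? x st out))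
  popWhile-ascending         []       out []           = [] ∷ []
  popWhile-ascending {x} (y ∷ st) out (y≤st ∷ st↗) rewrite pop?-spec x y st with y <ᵇ x in y<ᵇx
  ... | true  = popWhile-ascending st (out ++ [ y ]) st↗
  ... | false = (x≤y ∷ All.map (≤-trans x≤y) y≤st) ∷ y≤st ∷ st↗
    where
    x≤y : x ≤ y
    x≤y = Equivalence.to <ᵇ≡false⇔≥ y<ᵇx

  ascending-top< : ∀ {x y b st} → AllPairs _≤_ (y ∷ st) → b ∈ y ∷ st → b < x → y < x
  ascending-top< _          (here refl)  b<x = b<x
  ascending-top< (y≤st ∷ _) (there b∈st) b<x = ≤-<-trans (All.lookup y≤st b∈st) b<x

  popWhile-pops : ∀ {x b} st out → AllPairs _≤_ st → b ∈ st → b < x → b ∈ proj₂ (popWhile pop? x st out)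
  popWhile-pops {x} (y ∷ st) out st↗@(_ ∷ st′↗) b∈ b<x
    rewrite pop?-spec x y st | Equivalence.from <ᵇ≡true⇔< (ascending-top< st↗ b∈ b<x) with b∈
  ... | here refl  = popWhile-keeps-out pop? x st (out ++ [ y ]) (∈-++⁺ʳ out (here refl))
  ... | there b∈st = popWhile-pops st (out ++ [ y ]) st′↗ b∈st b<x

  stacked-inversion : ∀ {a b c} xs st out → AllPairs _≤_ st → b ∈ st → (c ∷ a ∷ []) ⊆ xs → b < c →
    (b ∷ a ∷ []) ⊆ runStack pop? xs st out
  stacked-inversion (x ∷ xs) st out st↗ b∈st (refl ∷ a⊆xs) b<x =
    runStack-precedes pop? xs _ _ (popWhile-pops st out st↗ b∈st b<x) (∈-++⁺ʳ _ (to∈ a⊆xs))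
  stacked-inversion (x ∷ xs) st out st↗ b∈st (x ∷ʳ ca⊆xs) b<c
    with popWhile-stack⊎out pop? x st out b∈st
  ... | inj₁ b∈st′  = stacked-inversion xs _ _ (popWhile-ascending st out st↗) (there b∈st′) ca⊆xs b<c
  ... | inj₂ b∈out′ = runStack-precedes pop? xs _ _ b∈out′ (∈-++⁺ʳ _ (to∈ (Sublistₚ.∷ˡ⁻ ca⊆xs)))

  231⇒inversion : ∀ {a b c} xs st out → AllPairs _≤_ st → (b ∷ c ∷ a ∷ []) ⊆ xs → b < c →
    (b ∷ a ∷ []) ⊆ runStack pop? xs st out
  231⇒inversion (x ∷ xs) st out st↗ (refl ∷ ca⊆xs) b<c =
    stacked-inversion xs _ _ (popWhile-ascending st out st↗) (here refl) ca⊆xs b<c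
  231⇒inversion (x ∷ xs) st out st↗ (x ∷ʳ bca⊆xs) b<c =
    231⇒inversion xs _ _ (popWhile-ascending st out st↗) bca⊆xs b<c

west-sorts⇔avoids231 : ∀ {n w} → w ↭ idPerm n → west w ≡ idPerm n ⇔ (¬ Has231 _<_ w)
west-sorts⇔avoids231 {n} {w} w↭id = mk⇔ sorts⇒avoids avoids⇒sorts
  where
  sorts⇒avoids : west w ≡ idPerm n → ¬ Has231 _<_ w
  sorts⇒avoids sorts (b , c , a , bca⊆w , a<b , b<c)
    with AllPairs-resp-⊆
           (subst (_ ⊆_) sorts (WestStack.231⇒inversion _ (λ _ _ _ → refl) w [] [] [] bca⊆w b<c))
           (idPerm-increasing n)
  ... | (b<a ∷ []) ∷ _ = <-asym a<b b<a

  avoids⇒sorts : ¬ Has231 _<_ w → west w ≡ idPerm n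
  avoids⇒sorts no231 = ascending-↭⇒≡ (WestStack.avoids231⇒ascending _ (λ _ _ _ → refl) no231)
    (AllPairs.map <⇒≤ (idPerm-increasing n)) (↭-trans (runStack-↭ _ w) w↭id)

-- Occurrences of underlined patterns

Tight : Bool → List ℕ → Set
Tight b G = T b → G ≡ []

-- Span u (v₁ ⋯ vₘ) s: s = v₁ G₁ v₂ ⋯ Gₘ₋₁ vₘ with the gap Gᵢ empty when the i-th bit of u is set.
data Span : List Bool → List ℕ → List ℕ → Set where
  single : ∀ v → Span [] [ v ] [ v ]
  link   : ∀ {b u v w vs s} G → Tight b G → Span u (w ∷ vs) s →
           Span (b ∷ u) (v ∷ w ∷ vs) (v ∷ G ++ s)

record Occurrence (u : List Bool) (vs w : List ℕ) : Set where
  constructor occurrence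
  field
    before span after : List ℕ
    isSpan            : Span u vs span
    splits            : w ≡ before ++ span ++ after

span-head : ∀ {u v vs s} → Span u (v ∷ vs) s → v ∈ s
span-head (single v)   = here refl
span-head (link G _ _) = here refl

span-⊆ : ∀ {u vs s} → Span u vs s → vs ⊆ s
span-⊆ (single v)    = ⊆-refl
span-⊆ (link G _ sp) = refl ∷ Sublistₚ.++⁺ˡ G (span-⊆ sp)

span-snoc : ∀ {u vs s b G} v → Span u vs s → Tight b G → Span (u ++ [ b ]) (vs ++ [ v ]) (s ++ G ++ [ v ])
span-snoc v (single w) t = link _ t (single v)
span-snoc {G = G} v (link {s = s} H tH sp) t rewrite ++-assoc H s (G ++ [ v ]) = link H tH (span-snoc v sp t)

span-reverse : ∀ {u vs s} → Span u vs s → Span (reverse u) (reverse vs) (reverse s)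
span-reverse (single v) = single v
span-reverse (link {b} {u} {v} {w} {vs} {s} G t sp)
  rewrite unfold-reverse b u | unfold-reverse v (w ∷ vs) | unfold-reverse v (G ++ s)
        | reverse-++ G s | ++-assoc (reverse s) (reverse G) [ v ] =
  span-snoc v (span-reverse sp) (cong reverse ∘ t)

occurrence-⊆ : ∀ {u vs w} → Occurrence u vs w → vs ⊆ w
occurrence-⊆ (occurrence before span after sp refl) = Sublistₚ.++⁺ˡ before (Sublistₚ.++⁺ʳ after (span-⊆ sp))

occurrence-∷ : ∀ {u vs w} y → Occurrence u vs w → Occurrence u vs (y ∷ w)
occurrence-∷ y (occurrence before span after sp w≡) = occurrence (y ∷ before) span after sp (cong (y ∷_) w≡)

occurrence-reverse : ∀ {u vs w} → Occurrence u vs w → Occurrence (reverse u) (reverse vs) (reverse w)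
occurrence-reverse (occurrence before span after sp refl) =
  occurrence (reverse after) (reverse span) (reverse before) (span-reverse sp) reverse-split
  where
  open ≡-Reasoning
  reverse-split : reverse (before ++ span ++ after) ≡ reverse after ++ reverse span ++ reverse before
  reverse-split = begin
    reverse (before ++ span ++ after)
      ≡⟨ reverse-++ before (span ++ after) ⟩
    reverse (span ++ after) ++ reverse before
      ≡⟨ cong (_++ reverse before) (reverse-++ span after) ⟩
    (reverse after ++ reverse span) ++ reverse before
      ≡⟨ ++-assoc (reverse after) (reverse span) (reverse before) ⟩
    reverse after ++ reverse span ++ reverse before
      ∎

⊆⇒occurrence : ∀ {v vs w} → (v ∷ vs) ⊆ w → Occurrence (map (λ _ → false) vs) (v ∷ vs) w
⊆⇒occurrence (y ∷ʳ vs⊆w) = occurrence-∷ y (⊆⇒occurrence vs⊆w)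
⊆⇒occurrence {v} {[]}    (refl ∷ _)    = occurrence [] [ v ] _ (single v) refl
⊆⇒occurrence {v} {_ ∷ _} (refl ∷ vs⊆w) with ⊆⇒occurrence vs⊆w
... | occurrence before span after sp refl =
  occurrence [] (v ∷ before ++ span) after (link before (λ ()) sp)
    (cong (v ∷_) (sym (++-assoc before span after)))

occurrence-pinned : ∀ {u a b c vs x z rest} → Occurrence u (a ∷ b ∷ c ∷ vs) (x ∷ z ∷ rest) →
  ¬ Occurrence u (a ∷ b ∷ c ∷ vs) (z ∷ rest) → ¬ Occurrence u (a ∷ b ∷ c ∷ vs) (x ∷ rest) →
  a ≡ x × b ≡ z × c ∈ rest
occurrence-pinned (occurrence (_ ∷ before) span after sp w≡) ¬z _ =
  contradiction (occurrence before span after sp (∷-injectiveʳ w≡)) ¬z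
occurrence-pinned (occurrence [] _ after (link (_ ∷ G) t sp) refl) _ ¬x =
  contradiction (occurrence [] _ after (link G (λ tb → contradiction (t tb) λ ()) sp) refl) ¬x
occurrence-pinned (occurrence [] _ after (link [] _ (link G _ sp)) refl) _ _ =
  refl , refl , ∈-++⁺ˡ (∈-++⁺ʳ G (span-head sp))

indexed : ℕ → List ℕ → List (ℕ × ℕ)
indexed i []      = []
indexed i (x ∷ w) = (i , x) ∷ indexed (suc i) w

zip-applyUpTo : ∀ (f : ℕ → ℕ) i w → (∀ j → f j ≡ i + j) → zip (applyUpTo f (length w)) w ≡ indexed i w
zip-applyUpTo f i []      f≗ = refl
zip-applyUpTo f i (x ∷ w) f≗ = cong₂ _∷_
  (cong (_, x) (trans (f≗ 0) (+-identityʳ i)))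
  (zip-applyUpTo (f ∘ suc) (suc i) w (λ j → trans (f≗ (suc j)) (+-suc i j)))

zip-upTo : ∀ w → zip (upTo (length w)) w ≡ indexed 0 w
zip-upTo w = zip-applyUpTo (λ j → j) 0 w (λ _ → refl)

indexed-++ : ∀ i v w → indexed i (v ++ w) ≡ indexed i v ++ indexed (i + length v) w
indexed-++ i []      w = cong (λ j → indexed j w) (sym (+-identityʳ i))
indexed-++ i (x ∷ v) w = cong ((i , x) ∷_)
  (trans (indexed-++ (suc i) v w) (cong (λ j → indexed (suc i) v ++ indexed j w) (sym (+-suc i (length v)))))

∈-choose⁻ : ∀ {A : Set} m {xs c : List A} → c ∈ choose m xs → c ⊆ xs × length c ≡ m
∈-choose⁻ zero    {xs}     (here refl) = Sublistₚ.[]⊆-universal xs , refl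
∈-choose⁻ (suc m) {x ∷ xs} c∈ with ∈-++⁻ (map (x ∷_) (choose m xs)) c∈
... | inj₂ c∈′ = let c⊆ , len = ∈-choose⁻ (suc m) c∈′ in x ∷ʳ c⊆ , len
... | inj₁ c∈′ with ∈-map⁻ (x ∷_) c∈′
...   | c′ , c′∈ , refl = let c′⊆ , len = ∈-choose⁻ m c′∈ in refl ∷ c′⊆ , cong suc len

∈-choose⁺ : ∀ {A : Set} {xs c : List A} → c ⊆ xs → c ∈ choose (length c) xs
∈-choose⁺ []                    = here refl
∈-choose⁺ {c = []}    (_ ∷ʳ _)  = here refl
∈-choose⁺ {c = _ ∷ _} (_ ∷ʳ c⊆) = ∈-++⁺ʳ _ (∈-choose⁺ c⊆)
∈-choose⁺ (refl ∷ c⊆)           = ∈-++⁺ˡ (∈-map⁺ _ (∈-choose⁺ c⊆))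

adjacent⇒tight : ∀ {b q i} G → q ≡ suc i + length G → T (not b ∨ (q ≡ᵇ suc i)) → Tight b G
adjacent⇒tight {false} G       _  _ ()
adjacent⇒tight {true}  []      _  _ _ = refl
adjacent⇒tight {true} {q} {i} (_ ∷ G) q≡ adj _
  with +-cancelˡ-≡ (suc i) _ 0 (trans (sym q≡) (trans (≡ᵇ⇒≡ q (suc i) adj) (sym (+-identityʳ (suc i)))))
... | ()

tight⇒adjacent : ∀ {b} i G → Tight b G → T (not b ∨ (suc i + length G ≡ᵇ suc i))
tight⇒adjacent {false} i G t = _
tight⇒adjacent {true}  i G t rewrite t _ = ≡⇒≡ᵇ (suc i + 0) (suc i) (+-identityʳ (suc i))

indexed⇒occurrence : ∀ {u i w p x} c → ((p , x) ∷ c) ⊆ indexed i w → T (adjOK u (p ∷ map proj₁ c)) →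
  length c ≡ length u → Σ[ o ∈ Occurrence u (x ∷ map proj₂ c) w ] p ≡ i + length (Occurrence.before o)
indexed⇒occurrence {w = y ∷ w} c (_ ∷ʳ c⊆) adj len with indexed⇒occurrence c c⊆ adj len
... | o , p≡ = occurrence-∷ y o , trans p≡ (sym (+-suc _ _))
indexed⇒occurrence {[]} {i} {x ∷ w} [] (refl ∷ _) _ _ = occurrence [] [ x ] w (single x) refl , sym (+-identityʳ i)
indexed⇒occurrence {b ∷ u} {i} {x ∷ w} ((q , y) ∷ c) (refl ∷ c⊆) adj len with Equivalence.to T-∧ adj
... | adj-b , adj-u with indexed⇒occurrence c c⊆ adj-u (suc-injective len)
...   | occurrence before span after sp refl , q≡ =
  occurrence [] (x ∷ before ++ span) after (link before (adjacent⇒tight before q≡ adj-b) sp)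
    (cong (x ∷_) (sym (++-assoc before span after))) ,
  sym (+-identityʳ i)
indexed⇒occurrence {[]}    {w = _ ∷ _} (_ ∷ _) (refl ∷ _) _ ()
indexed⇒occurrence {_ ∷ _} {w = _ ∷ _} []      (refl ∷ _) _ ()

span⇒indexed : ∀ {u v vs s} → Span u (v ∷ vs) s → ∀ i →
  Σ[ c ∈ List (ℕ × ℕ) ] ((i , v) ∷ c) ⊆ indexed i s × map proj₂ c ≡ vs × T (adjOK u (i ∷ map proj₁ c))
span⇒indexed (single v) i = [] , refl ∷ [] , refl , _
span⇒indexed (link {s = s} G t sp) i with span⇒indexed sp (suc i + length G)
... | c , c⊆ , c≡ , adj =
  (suc i + length G , _) ∷ c ,
  refl ∷ subst (_ ⊆_) (sym (indexed-++ (suc i) G s)) (Sublistₚ.++⁺ˡ (indexed (suc i) G) c⊆) ,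
  cong (_ ∷_) c≡ ,
  Equivalence.from T-∧ (tight⇒adjacent i G t , adj)

occurrence⇒indexed : ∀ {u v vs w} → Occurrence u (v ∷ vs) w →
  Σ[ c ∈ List (ℕ × ℕ) ] c ⊆ indexed 0 w × map proj₂ c ≡ v ∷ vs × T (adjOK u (map proj₁ c))
occurrence⇒indexed (occurrence before span after sp refl) with span⇒indexed sp (length before)
... | c , c⊆ , c≡ , adj = _ ∷ c , subst (_ ⊆_) (sym indexed-split) c⊆w , cong (_ ∷_) c≡ , adj
  where
  c⊆w : _ ⊆ indexed 0 before ++ indexed (length before) span ++ indexed (length before + length span) after
  c⊆w = Sublistₚ.++⁺ˡ (indexed 0 before) (Sublistₚ.++⁺ʳ (indexed (length before + length span) after) c⊆)
  indexed-split : indexed 0 (before ++ span ++ after)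
                ≡ indexed 0 before ++ indexed (length before) span ++ indexed (length before + length span) after
  indexed-split = trans (indexed-++ 0 before (span ++ after))
                        (cong (indexed 0 before ++_) (indexed-++ (length before) span after))

orderIso-length : ∀ σ vs → T (orderIso σ vs) → length vs ≡ length σ
orderIso-length []      []       _   = refl
orderIso-length (_ ∷ σ) (_ ∷ vs) iso = cong suc (orderIso-length σ vs (proj₂ (Equivalence.to T-∧ iso)))

contains⇔occurrence : ∀ {σ u} w → suc (length u) ≡ length σ →
  T (contains w (σ , u)) ⇔ (∃[ vs ] Occurrence u vs w × T (orderIso σ vs))
contains⇔occurrence {σ} {u} w len = mk⇔ to from
  where
  test : List (ℕ × ℕ) → Bool
  test c = orderIso σ (map proj₂ c) ∧ adjOK u (map proj₁ c)

  candidates : List (List (ℕ × ℕ))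
  candidates = choose (length σ) (zip (upTo (length w)) w)

  to : T (contains w (σ , u)) → ∃[ vs ] Occurrence u vs w × T (orderIso σ vs)
  to h with find (any⁻ test candidates h)
  ... | c , c∈ , test-c
    with ∈-choose⁻ (length σ) c∈ | Equivalence.to (T-∧ {orderIso σ (map proj₂ c)}) test-c
  ...   | c⊆ , c-length | iso , adj with c | subst (c ⊆_) (zip-upTo w) c⊆
  ...     | []           | _   = contradiction (trans len (sym c-length)) λ ()
  ...     | (p , x) ∷ c′ | c⊆′ =
    _ , proj₁ (indexed⇒occurrence c′ c⊆′ adj (suc-injective (trans c-length (sym len)))) , iso

  from : ∃[ vs ] Occurrence u vs w × T (orderIso σ vs) → T (contains w (σ , u))
  from ([] , occurrence _ _ _ () _ , _)
  from (v ∷ vs , o , iso) with occurrence⇒indexed o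
  ... | c , c⊆ , c≡ , adj =
    any⁺ {xs = candidates} test
      (lose c∈ (Equivalence.from T-∧ (subst (T ∘ orderIso σ) (sym c≡) iso , adj)))
    where
    c-length : length c ≡ length σ
    c-length = trans (trans (sym (length-map proj₂ c)) (cong length c≡)) (orderIso-length σ _ iso)
    c∈ : c ∈ candidates
    c∈ = subst₂ (λ m l → c ∈ choose m l) c-length (sym (zip-upTo w)) (∈-choose⁺ c⊆)

-- Order-isomorphism with monotone patterns

==-≡ : ∀ β {x} → T (β == x) ⇔ x ≡ β
==-≡ true  {true}  = mk⇔ (λ _ → refl) (λ _ → _)
==-≡ true  {false} = mk⇔ (λ ()) (λ ())
==-≡ false {true}  = mk⇔ (λ ()) (λ ())
==-≡ false {false} = mk⇔ (λ _ → refl) (λ _ → _)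

module _ {R : ℕ → ℕ → Set} (β : Bool) (R⇔ : ∀ {a b} → (a <ᵇ b) ≡ β ⇔ R a b) where

  orderIso-row : ∀ {s v} ss vs → length ss ≡ length vs → All (R s) ss →
    T (all (λ q → (s <ᵇ proj₁ q) == (v <ᵇ proj₂ q)) (zip ss vs)) ⇔ All (R v) vs
  orderIso-row []        []        _   []             = mk⇔ (λ _ → []) (λ _ → _)
  orderIso-row {s} {v} (s′ ∷ ss) (v′ ∷ vs) len (s≺s′ ∷ s≺ss) = mk⇔ to from
    where
    row : T (all (λ q → (s <ᵇ proj₁ q) == (v <ᵇ proj₂ q)) (zip ss vs)) ⇔ All (R v) vs
    row = orderIso-row ss vs (suc-injective len) s≺ss
    head : T ((s <ᵇ s′) == (v <ᵇ v′)) ⇔ R v v′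
    head rewrite Equivalence.from R⇔ s≺s′ = ⇔.trans (==-≡ β) R⇔
    to : T (((s <ᵇ s′) == (v <ᵇ v′)) ∧ all _ (zip ss vs)) → All (R v) (v′ ∷ vs)
    to h with Equivalence.to (T-∧ {(s <ᵇ s′) == (v <ᵇ v′)}) h
    ... | h-v′ , h-vs = Equivalence.to head h-v′ ∷ Equivalence.to row h-vs
    from : All (R v) (v′ ∷ vs) → T (((s <ᵇ s′) == (v <ᵇ v′)) ∧ all _ (zip ss vs))
    from (v≺v′ ∷ v≺vs) = Equivalence.from T-∧ (Equivalence.from head v≺v′ , Equivalence.from row v≺vs)

  orderIso-uniform : ∀ σ {vs} → AllPairs R σ → T (orderIso σ vs) ⇔ (length vs ≡ length σ × AllPairs R vs)
  orderIso-uniform []      {[]}     _ = mk⇔ (λ _ → refl , []) (λ _ → _)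
  orderIso-uniform []      {_ ∷ _}  _ = mk⇔ (λ ()) (λ ())
  orderIso-uniform (_ ∷ _) {[]}     _ = mk⇔ (λ ()) (λ ())
  orderIso-uniform (s ∷ σ) {v ∷ vs} (s≺σ ∷ σ↑) = mk⇔ to from
    where
    tail : T (orderIso σ vs) ⇔ (length vs ≡ length σ × AllPairs R vs)
    tail = orderIso-uniform σ σ↑
    to : T (orderIso (s ∷ σ) (v ∷ vs)) → length (v ∷ vs) ≡ length (s ∷ σ) × AllPairs R (v ∷ vs)
    to h with Equivalence.to (T-∧ {all _ (zip σ vs)}) h
    ... | h-row , h-tail with Equivalence.to tail h-tail
    ...   | len , vs↑ = cong suc len , Equivalence.to (orderIso-row σ vs (sym len) s≺σ) h-row ∷ vs↑
    from : length (v ∷ vs) ≡ length (s ∷ σ) × AllPairs R (v ∷ vs) → T (orderIso (s ∷ σ) (v ∷ vs))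
    from (len , v≺vs ∷ vs↑) = Equivalence.from T-∧
      (Equivalence.from (orderIso-row σ vs (sym (suc-injective len)) s≺σ) v≺vs ,
       Equivalence.from tail (suc-injective len , vs↑))

decr-length : ∀ k → length (decr k) ≡ k
decr-length k = trans (length-map suc (downFrom k)) (length-downFrom k)

decr-descending : ∀ k → AllPairs _>_ (decr k)
decr-descending k = AllPairsₚ.map⁺ (AllPairsₚ.applyDownFrom⁺₁ (λ i → i) k (λ j<i _ → s<s j<i))

orderIso-decr : ∀ k {vs} → T (orderIso (decr k) vs) ⇔ (length vs ≡ length (decr k) × AllPairs _≥_ vs)
orderIso-decr k = orderIso-uniform false <ᵇ≡false⇔≥ (decr k) (AllPairs.map <⇒≤ (decr-descending k))

orderIso-reverse-decr : ∀ k {vs} →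
  T (orderIso (reverse (decr k)) vs) ⇔ (length vs ≡ length (reverse (decr k)) × AllPairs _<_ vs)
orderIso-reverse-decr k =
  orderIso-uniform true <ᵇ≡true⇔< (reverse (decr k)) (AllPairs-reverse (decr-descending k))

orderIso-132⁻ : ∀ vs → T (orderIso (1 ∷ 3 ∷ 2 ∷ []) vs) →
  ∃[ a ] ∃[ c ] ∃[ b ] vs ≡ a ∷ c ∷ b ∷ [] × a < b × b ≤ c
orderIso-132⁻ vs iso with orderIso-length (1 ∷ 3 ∷ 2 ∷ []) vs iso
orderIso-132⁻ (a ∷ c ∷ b ∷ []) iso | _ with a <ᵇ c | a <ᵇ b in a<ᵇb | c <ᵇ b in c<ᵇb
... | true  | true  | false =
  a , c , b , refl , Equivalence.to <ᵇ≡true⇔< a<ᵇb , Equivalence.to <ᵇ≡false⇔≥ c<ᵇb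
orderIso-132⁻ (a ∷ c ∷ b ∷ []) () | _ | false | _     | _
orderIso-132⁻ (a ∷ c ∷ b ∷ []) () | _ | true  | false | _
orderIso-132⁻ (a ∷ c ∷ b ∷ []) () | _ | true  | true  | true

orderIso-132⁺ : ∀ {a c b} → a < b → b < c → T (orderIso (1 ∷ 3 ∷ 2 ∷ []) (a ∷ c ∷ b ∷ []))
orderIso-132⁺ a<b b<c
  rewrite Equivalence.from <ᵇ≡true⇔< (<-trans a<b b<c) | Equivalence.from <ᵇ≡true⇔< a<b
        | Equivalence.from <ᵇ≡false⇔≥ (<⇒≤ b<c) = _

contains-132⇔231 : ∀ {τ} → Unique τ → T (contains τ p132) ⇔ Has231 _<_ (reverse τ)
contains-132⇔231 {τ} τ! = mk⇔ to from
  where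
  to : T (contains τ p132) → Has231 _<_ (reverse τ)
  to h with Equivalence.to (contains⇔occurrence τ refl) h
  ... | vs , o , iso with orderIso-132⁻ vs iso
  ...   | a , c , b , refl , a<b , b≤c with AllPairs-resp-⊆ (occurrence-⊆ o) τ!
  ...     | _ ∷ (c≢b ∷ []) ∷ _ =
    b , c , a , Sublistₚ.reverse⁺ (occurrence-⊆ o) , a<b , ≤∧≢⇒< b≤c (c≢b ∘ sym)

  from : Has231 _<_ (reverse τ) → T (contains τ p132)
  from (b , c , a , bca⊆ , a<b , b<c) = Equivalence.from (contains⇔occurrence τ refl)
    (_ , ⊆⇒occurrence (Sublistₚ.reverse⁻ {as = a ∷ c ∷ b ∷ []} {bs = τ} bca⊆) , orderIso-132⁺ a<b b<c)

-- Stack maps popping while a pattern is contained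

-- The properties of containing a decreasing pattern of length at least 3 that the argument uses.
module PatternStack
  (p : List ℕ → Bool)
  (p-∷ : ∀ y {w} → T (p w) → T (p (y ∷ w)))
  (p-[_] : ∀ x → ¬ T (p [ x ]))
  (p-pinned : ∀ {x z rest} → T (p (x ∷ z ∷ rest)) → ¬ T (p (z ∷ rest)) → ¬ T (p (x ∷ rest)) →
              ∃[ c ] c ∈ rest × c ≤ z × z ≤ x)
  where

  pop? : ℕ → List ℕ → Bool
  pop? x st = p (x ∷ st)

  p-ʳ++ : ∀ xs {w} → T (p w) → T (p (xs ʳ++ w))
  p-ʳ++ []       h = h
  p-ʳ++ (x ∷ xs) h = p-ʳ++ xs (p-∷ x h)

  popWhile-idle : ∀ {x} st out → ¬ T (p (x ∷ st)) → popWhile pop? x st out ≡ (st , out)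
  popWhile-idle []       out _  = refl
  popWhile-idle (y ∷ st) out ¬p rewrite Equivalence.from ≡false⇔¬T ¬p = refl

  runStack-idle : ∀ xs st out → ¬ T (p (xs ʳ++ st)) → runStack pop? xs st out ≡ out ++ xs ʳ++ st
  runStack-idle []       st out _  = refl
  runStack-idle (x ∷ xs) st out ¬p rewrite popWhile-idle st out (¬p ∘ p-ʳ++ xs) =
    runStack-idle xs (x ∷ st) out ¬p

  popWhile-critical : ∀ {x} st out → ¬ T (p st) → T (p (x ∷ st)) →
    ∃[ z ] ∃[ c ] z ∈ proj₂ (popWhile pop? x st out) × c ∈ proj₁ (popWhile pop? x st out) × c ≤ z × z ≤ x
  popWhile-critical {x} []       out _  h = contradiction h p-[ x ]
  popWhile-critical {x} (y ∷ st) out ¬p h rewrite Equivalence.to T-≡ h with p (x ∷ st) in x∷st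
  ... | true  = popWhile-critical st (out ++ [ y ]) (¬p ∘ p-∷ y) (Equivalence.from T-≡ x∷st)
  ... | false rewrite popWhile-idle st (out ++ [ y ]) (Equivalence.to ≡false⇔¬T x∷st)
    with p-pinned h ¬p (Equivalence.to ≡false⇔¬T x∷st)
  ...   | c , c∈ , c≤y , y≤x = y , c , ∈-++⁺ʳ out (here refl) , c∈ , c≤y , y≤x

  runStack-231 : ∀ xs st out → ¬ T (p st) → T (p (xs ʳ++ st)) → Has231 _≤_ (runStack pop? xs st out)
  runStack-231 []       st out ¬p h = contradiction h ¬p
  runStack-231 (x ∷ xs) st out ¬p h with p (x ∷ st) in x∷st
  ... | false rewrite popWhile-idle st out (Equivalence.to ≡false⇔¬T x∷st) =
    runStack-231 xs (x ∷ st) out (Equivalence.to ≡false⇔¬T x∷st) h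
  ... | true with popWhile-critical st out ¬p (Equivalence.from T-≡ x∷st)
  ...   | z , c , z∈ , c∈ , c≤z , z≤x =
    z , x , c , runStack-⊇ pop? xs _ _ (from∈ z∈) (refl ∷ from∈ c∈) , c≤z , z≤x

  stackMap-idle : ∀ τ → ¬ T (p (reverse τ)) → runStack pop? τ [] [] ≡ reverse τ
  stackMap-idle τ = runStack-idle τ [] []

  stackMap-231 : ∀ τ → T (p (reverse τ)) → Has231 _≤_ (runStack pop? τ [] [])
  stackMap-231 τ = runStack-231 τ [] [] (λ h → p-[ 0 ] (p-∷ 0 h))

module DecreasingPattern (k : ℕ) (u : List Bool) (u-length : length u ≡ suc (suc k)) where

  σ : Pattern
  σ = decr (3 + k) , u

  contains-σ⇔ : ∀ w →
    T (contains w σ) ⇔ (∃[ vs ] Occurrence u vs w × length vs ≡ length (decr (3 + k)) × AllPairs _≥_ vs)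
  contains-σ⇔ w = mk⇔
    (λ h → let vs , o , iso = Equivalence.to (contains⇔occurrence w σ-length) h
           in vs , o , Equivalence.to (orderIso-decr (3 + k)) iso)
    (λ (vs , o , shape) → Equivalence.from (contains⇔occurrence w σ-length)
                            (vs , o , Equivalence.from (orderIso-decr (3 + k)) shape))
    where
    σ-length : suc (length u) ≡ length (decr (3 + k))
    σ-length = cong suc (trans u-length (sym (decr-length (2 + k))))

  σ-∷ : ∀ y {w} → T (contains w σ) → T (contains (y ∷ w) σ)
  σ-∷ y {w} h with Equivalence.to (contains-σ⇔ w) h
  ... | vs , o , shape = Equivalence.from (contains-σ⇔ (y ∷ w)) (vs , occurrence-∷ y o , shape)

  σ-[_] : ∀ x → ¬ T (contains [ x ] σ)
  σ-[ x ] ()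

  σ-pinned : ∀ {x z rest} → T (contains (x ∷ z ∷ rest) σ) → ¬ T (contains (z ∷ rest) σ) →
    ¬ T (contains (x ∷ rest) σ) → ∃[ c ] c ∈ rest × c ≤ z × z ≤ x
  σ-pinned {x} {z} {rest} h ¬z ¬x with Equivalence.to (contains-σ⇔ (x ∷ z ∷ rest)) h
  ... | a ∷ b ∷ c ∷ vs , o , len , desc@((b≤a ∷ _) ∷ (c≤b ∷ _) ∷ _)
    with occurrence-pinned o (λ o′ → ¬z (Equivalence.from (contains-σ⇔ (z ∷ rest)) (_ , o′ , len , desc)))
                             (λ o′ → ¬x (Equivalence.from (contains-σ⇔ (x ∷ rest)) (_ , o′ , len , desc)))
  ...   | refl , refl , c∈ = c , c∈ , c≤b , b≤a

  open PatternStack (λ w → contains w σ) σ-∷ σ-[_] σ-pinned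

  contains-revPat⇔ : ∀ {τ} → Unique τ → T (contains τ (revPat σ)) ⇔ T (contains (reverse τ) σ)
  contains-revPat⇔ {τ} τ! = mk⇔ to from
    where
    revσ-length : suc (length (reverse u)) ≡ length (reverse (decr (3 + k)))
    revσ-length = trans (cong suc (trans (length-reverse u) u-length))
                        (sym (trans (length-reverse (decr (3 + k))) (decr-length (3 + k))))

    revσ⇔ : T (contains τ (revPat σ))
          ⇔ (∃[ vs ] Occurrence (reverse u) vs τ × T (orderIso (reverse (decr (3 + k))) vs))
    revσ⇔ = contains⇔occurrence {reverse (decr (3 + k))} {reverse u} τ revσ-length

    to : T (contains τ (revPat σ)) → T (contains (reverse τ) σ)
    to h with Equivalence.to revσ⇔ h
    ... | vs , o , iso with Equivalence.to (orderIso-reverse-decr (3 + k)) iso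
    ...   | len , asc = Equivalence.from (contains-σ⇔ (reverse τ))
      (reverse vs ,
       subst (λ u′ → Occurrence u′ (reverse vs) (reverse τ)) (reverse-involutive u) (occurrence-reverse o) ,
       trans (length-reverse vs) (trans len (length-reverse (decr (3 + k)))) ,
       AllPairs.map <⇒≤ (AllPairs-reverse asc))

    from : T (contains (reverse τ) σ) → T (contains τ (revPat σ))
    from h with Equivalence.to (contains-σ⇔ (reverse τ)) h
    ... | vs , o , len , desc = Equivalence.from revσ⇔
      (reverse vs , o′ ,
       Equivalence.from (orderIso-reverse-decr (3 + k))
         (trans (length-reverse vs) (trans len (sym (length-reverse (decr (3 + k))))) ,
          AllPairs.zipWith (λ (a≤b , a≢b) → ≤∧≢⇒< a≤b a≢b)
            (AllPairs-reverse desc , AllPairs-resp-⊆ (occurrence-⊆ o′) τ!)))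
      where
      o′ : Occurrence (reverse u) (reverse vs) τ
      o′ = subst (Occurrence (reverse u) (reverse vs)) (reverse-involutive τ)
                 (occurrence-reverse {w = reverse τ} o)

  sPat-idle : ∀ {τ} → Unique τ → Avoids τ (revPat σ) → sPat σ τ ≡ reverse τ
  sPat-idle {τ} τ! avoids =
    stackMap-idle τ (Equivalence.to ≡false⇔¬T avoids ∘ Equivalence.from (contains-revPat⇔ τ!))

  sPat-231 : ∀ {τ} → Unique τ → T (contains τ (revPat σ)) → Has231 _≤_ (sPat σ τ)
  sPat-231 {τ} τ! = stackMap-231 τ ∘ Equivalence.to (contains-revPat⇔ τ!)

mainTheorem3 : (k : ℕ) → 3 ≤ k → (u : List Bool) → length u ≡ k ∸ 1 →
    (n : ℕ) → 1 ≤ n → (τ : List ℕ) → τ ↭ idPerm n →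
    (west (sPat (decr k , u) τ) ≡ idPerm n)
      ⇔ (Avoids τ (revPat (decr k , u)) × Avoids τ p132)
mainTheorem3 _ (s≤s (s≤s (s≤s (z≤n {k})))) u u-length n _ τ τ↭id = mk⇔ sorted⇒avoids avoids⇒sorted
  where
  open DecreasingPattern k u u-length

  τ! : Unique τ
  τ! = ↭-idPerm⇒unique τ↭id

  reverse-sorts⇔ : west (reverse τ) ≡ idPerm n ⇔ (¬ Has231 _<_ (reverse τ))
  reverse-sorts⇔ = west-sorts⇔avoids231 (↭-trans (↭-reverse τ) τ↭id)

  sorted⇒avoids : west (sPat σ τ) ≡ idPerm n → Avoids τ (revPat σ) × Avoids τ p132
  sorted⇒avoids sorted =
    avoids-revσ , Equivalence.from ≡false⇔¬T (no231 ∘ Equivalence.to (contains-132⇔231 τ!))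
    where
    output↭id : sPat σ τ ↭ idPerm n
    output↭id = ↭-trans (runStack-↭ _ τ) τ↭id
    avoids-revσ : Avoids τ (revPat σ)
    avoids-revσ = Equivalence.from ≡false⇔¬T λ h →
      Equivalence.to (west-sorts⇔avoids231 output↭id) sorted (unique⇒strict231 (↭-idPerm⇒unique output↭id) (sPat-231 τ! h))
    no231 : ¬ Has231 _<_ (reverse τ)
    no231 = Equivalence.to reverse-sorts⇔ (subst (λ w → west w ≡ idPerm n) (sPat-idle τ! avoids-revσ) sorted)

  avoids⇒sorted : Avoids τ (revPat σ) × Avoids τ p132 → west (sPat σ τ) ≡ idPerm n
  avoids⇒sorted (avoids-revσ , avoids-132) = trans (cong west (sPat-idle τ! avoids-revσ))
    (Equivalence.from reverse-sorts⇔
      (Equivalence.to ≡false⇔¬T avoids-132 ∘ Equivalence.from (contains-132⇔231 τ!)))
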